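{- Let $P\in\mathbb{R}[x]$ be a polynomial of degree $m$ and $\mathbf{x}\in\mathbb{R}^{m+k+1}$. Suppose there exist $k+1$ linearly independent polynomials $Q_0,\dots,Q_k\in\mathbb{R}[x]$ of degree at most $k$ such that $\mathbf{a}(Q_iP)\in\langle\mathbf{x}\rangle^\perp$ for all $0\le i\le k$. Then $\mathbf{a}(P)\in\langle\mathbf{x}^{(0,m)},\mathbf{x}^{(1,m)},\dots,\mathbf{x}^{(k,m)}\rangle^\perp$.
   Context: For a polynomial $R=r_0+r_1x+\dots+r_dx^d$, $\mathbf{a}(R)=(r_0,r_1,\dots,r_d)$ is its coefficient vector, padded with zeros to the appropriate length when compared with vectors of larger dimension (so $\mathbf{a}(Q_iP)\in\mathbb{R}^{m+k+1}$ and $\mathbf{a}(P)\in\mathbb{R}^{m+1}$). For $\mathbf{x}=(x_0,\dots,x_{m+k})$, $\mathbf{x}^{(j,m)}=(x_j,x_{j+1},\dots,x_{j+m})$. $\langle\cdot\rangle^\perp$ is the orthogonal complement of the span with respect to the standard dot product. -}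

module Defs where

open import Level using (Level; suc; _⊔_)
open import Data.Nat as ℕ using (ℕ; zero) renaming (suc to sucℕ)
open import Data.Nat.Properties using (_<?_)
open import Data.Fin using (Fin; toℕ; fromℕ<)
import Data.Fin as Fin
open import Data.Product using (Σ; ∃; _×_; _,_)
open import Relation.Nullary using (¬_; yes; no)
open import Algebra.Bundles using (CommutativeRing)

record Field (c ℓ : Level) : Set (suc (c ⊔ ℓ)) where
  field
    commutativeRing : CommutativeRing c ℓ
  open CommutativeRing commutativeRing public
  field
    0≉1     : ¬ (0# ≈ 1#)
    inverse : ∀ x → ¬ (x ≈ 0#) → Σ Carrier λ y → x * y ≈ 1#

module FieldDefs {c ℓ : Level} (𝔽 : Field c ℓ) where
  open Field 𝔽

  Vect : ℕ → Set c
  Vect n = Fin n → Carrier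

  sumF : ∀ n → (Fin n → Carrier) → Carrier
  sumF zero     f = 0#
  sumF (sucℕ n) f = f Fin.zero + sumF n (λ i → f (Fin.suc i))

  dot : ∀ {n} → Vect n → Vect n → Carrier
  dot {n} u v = sumF n (λ i → u i * v i)

  ext : ∀ {n} → Vect n → ℕ → Carrier
  ext {n} v t with t <? n
  ... | yes t<n = v (fromℕ< t<n)
  ... | no  _   = 0#

  -- Polynomials are represented by coefficient vectors:
  -- a polynomial of degree ≤ d is a Vect (suc d), entry t = coefficient of x^t.
  -- Degree exactly m: the coefficient of x^m is nonzero.
  HasDegree : ∀ m → Vect (ℕ.suc m) → Set ℓ
  HasDegree m p = ¬ (p (Fin.fromℕ m) ≈ 0#)

  -- a(Q P) ∈ F^(m+k+1): coefficient vector of the product of Q (deg ≤ k)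
  -- and P (deg ≤ m):   (QP)_n = Σ_{i ≤ k} q_i p_{n-i}   (p_t := 0 out of range)
  -- p_{n-i}, taken as 0 when i > n (or n-i > m)
  shiftedCoeff : ∀ {m} → Vect (sucℕ m) → ℕ → ℕ → Carrier
  shiftedCoeff p n i with i ℕ.≤? n
  ... | yes _ = ext p (n ℕ.∸ i)
  ... | no  _ = 0#

  mulCoeffs : ∀ {k m} → Vect (sucℕ k) → Vect (sucℕ m) → Vect (sucℕ (m ℕ.+ k))
  mulCoeffs {k} q p n = sumF (sucℕ k) (λ i → q i * shiftedCoeff p (toℕ n) (toℕ i))

  -- x^(j,m) = (x_j, …, x_{j+m}) for x ∈ F^(m+k+1), j ≤ k
  window : ∀ {m k} → Vect (sucℕ (m ℕ.+ k)) → Fin (sucℕ k) → Vect (sucℕ m)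
  window x j t = ext x (toℕ j ℕ.+ toℕ t)

  LinearIndependent : ∀ {r n} → (Fin r → Vect n) → Set (c ⊔ ℓ)
  LinearIndependent {r} {n} g =
    ∀ (a : Fin r → Carrier) →
      (∀ t → sumF r (λ j → a j * g j t) ≈ 0#) → ∀ j → a j ≈ 0#

  InSpan : ∀ {r n} → (Fin r → Vect n) → Vect n → Set (c ⊔ ℓ)
  InSpan {r} g w = ∃ λ (a : Fin r → Carrier) → ∀ t → w t ≈ sumF r (λ j → a j * g j t)

  InPerp : ∀ {r n} → Vect n → (Fin r → Vect n) → Set (c ⊔ ℓ)
  InPerp v g = ∀ w → InSpan g w → dot v w ≈ 0#

module _ {c ℓ : Level} (𝔽 : Field c ℓ) where
  open Field 𝔽
  open FieldDefs 𝔽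
  open import Data.Nat using () renaming (_+_ to _+ℕ_)

  Lemma4Statement : Set (c ⊔ ℓ)
  Lemma4Statement =
    ∀ (m k : ℕ) (P : Vect (sucℕ m)) (x : Vect (sucℕ (m +ℕ k)))
      (Q : Fin (sucℕ k) → Vect (sucℕ k)) →
    HasDegree m P →
    LinearIndependent Q →
    (∀ i → InPerp (mulCoeffs (Q i) P) (λ (_ : Fin 1) → x)) →
    InPerp P (window {m} {k} x)

{-# OPTIONS --safe #-}
module Submission where

-- Write bⱼ = a(P) · x⁽ʲ'ᵐ⁾. Expanding the product gives a(Q_i P) · x = Σⱼ q_ij bⱼ, so the
-- hypothesis says that the square matrix (q_ij) sends b to 0. Its rows are independent,
-- so its determinant is nonzero, and Cramer's rule (bⱼ · det ≈ 0) gives b = 0.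
-- Constructively a pivot cannot be chosen, but det ≉ 0 is a negative statement: it is
-- proved by Gaussian elimination under a double negation, after which bⱼ ≈ 0 follows
-- by multiplying with the inverse of det.

open import Level using (Level)
open import Algebra.Bundles using (CommutativeRing)
open import Data.Nat as ℕ using (ℕ; _<_; _≤_; _<?_; _≤?_)
import Data.Nat.Properties as NP
open import Data.Fin using (Fin; zero; suc; punchIn; punchOut; inject₁; toℕ; fromℕ<; _≟_)
open import Data.Fin.Properties
  using (punchInᵢ≢i; punchIn-punchOut; punchIn-injective; suc-injective; toℕ-injective; toℕ-inject₁;
         toℕ<n; toℕ-fromℕ<; fromℕ<-toℕ)
open import Data.Vec.Functional using (Vector; removeAt; updateAt)
open import Data.Vec.Functional.Properties using (updateAt-updates; updateAt-minimal; updateAt-id-local)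
open import Data.Product using (Σ; _,_; _×_; proj₁; proj₂)
open import Data.Sum using (_⊎_; inj₁; inj₂)
open import Data.Empty using (⊥-elim)
open import Function using (_∘_; const)
open import Relation.Binary.Definitions using (tri<; tri≈; tri>)
open import Relation.Binary.PropositionalEquality as ≡ using (_≡_; _≢_)
open import Relation.Nullary using (¬_; yes; no)
open import Defs

module Determinant {c ℓ : Level} (R : CommutativeRing c ℓ) where
  open CommutativeRing R hiding (zero)
  open import Algebra.Properties.Ring ring
    using (-‿involutive; +-inverseˡ-unique; -‿distribˡ-*; -‿distribʳ-*; -0#≈0#)
  open import Algebra.Properties.Semiring.Sum semiring
    using (sum; sum-cong-≋; sum-replicate-zero; sum-remove; ∑-distrib-+; *-distribˡ-sum)
  open import Algebra.Solver.Ring.NaturalCoefficients.Default commutativeSemiring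
    using (solve; _:+_; _:*_; _:=_)
  open import Data.Vec.Functional.Relation.Binary.Equality.Setoid setoid using (_≋_; ≋-reflexive)
  open import Relation.Binary.Reasoning.Setoid setoid

  sum-≈0 : ∀ {n} {f : Vector Carrier n} → (∀ i → f i ≈ 0#) → sum f ≈ 0#
  sum-≈0 {n} f≈0 = trans (sum-cong-≋ f≈0) (sum-replicate-zero n)

  sum-single : ∀ {n} (f : Vector Carrier n) i → (∀ j → j ≢ i → f j ≈ 0#) → sum f ≈ f i
  sum-single {ℕ.suc n} f i f≈0 = begin
    sum f                    ≈⟨ sum-remove f ⟩
    f i + sum (removeAt f i) ≈⟨ +-congˡ (sum-≈0 (λ j → f≈0 _ (punchInᵢ≢i i j))) ⟩
    f i + 0#                 ≈⟨ +-identityʳ _ ⟩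
    f i                      ∎

  sum-pair : ∀ {n} (f : Vector Carrier n) {i j} → i ≢ j →
             (∀ l → l ≢ i → l ≢ j → f l ≈ 0#) → sum f ≈ f i + f j
  sum-pair {ℕ.suc n} f {i} {j} i≢j f≈0 = begin
    sum f                                ≈⟨ sum-remove f ⟩
    f i + sum (removeAt f i)             ≈⟨ +-congˡ (sum-single (removeAt f i) (punchOut i≢j) off-pair) ⟩
    f i + f (punchIn i (punchOut i≢j))   ≡⟨ ≡.cong (λ l → f i + f l) (punchIn-punchOut i≢j) ⟩
    f i + f j                            ∎
    where
    off-pair : ∀ l → l ≢ punchOut i≢j → f (punchIn i l) ≈ 0#
    off-pair l l≢ = f≈0 _ (punchInᵢ≢i i l)
      (λ eq → l≢ (punchIn-injective i l _ (≡.trans eq (≡.sym (punchIn-punchOut i≢j)))))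

  Matrix : ℕ → Set c
  Matrix n = Fin n → Vector Carrier n

  sign : ∀ {n} → Fin n → Carrier
  sign zero    = 1#
  sign (suc i) = - sign i

  minor : ∀ {n} → Fin (ℕ.suc n) → Matrix (ℕ.suc n) → Matrix n
  minor i A j t = A (punchIn i j) (suc t)

  det : ∀ {n} → Matrix n → Carrier
  det {ℕ.zero}  A = 1#
  det {ℕ.suc n} A = sum (λ i → sign i * A i zero * det (minor i A))

  det-cong : ∀ {n} {A B : Matrix n} → (∀ i → A i ≋ B i) → det A ≈ det B
  det-cong {ℕ.zero}  A≋B = refl
  det-cong {ℕ.suc n} A≋B = sum-cong-≋ λ i →
    *-cong (*-congˡ {sign i} (A≋B i zero)) (det-cong (λ j t → A≋B (punchIn i j) (suc t)))

  det-linear : ∀ {n} (i : Fin n) (β γ : Carrier) {A B C : Matrix n} →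
               (∀ j → j ≢ i → A j ≋ B j) → (∀ j → j ≢ i → A j ≋ C j) →
               (∀ t → A i t ≈ β * B i t + γ * C i t) →
               det A ≈ β * det B + γ * det C
  det-linear {ℕ.suc n} i β γ {A} {B} {C} A≋B A≋C Aᵢ = begin
    det A                                  ≈⟨ sum-cong-≋ term ⟩
    sum (λ l → β * b l + γ * c′ l)         ≈⟨ ∑-distrib-+ (λ l → β * b l) (λ l → γ * c′ l) ⟩
    sum (λ l → β * b l) + sum (λ l → γ * c′ l)
                                           ≈⟨ sym (+-cong (*-distribˡ-sum β b) (*-distribˡ-sum γ c′)) ⟩
    β * det B + γ * det C                  ∎
    where
    b c′ : Vector Carrier (ℕ.suc n)
    b  l = sign l * B l zero * det (minor l B)
    c′ l = sign l * C l zero * det (minor l C)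
    term : ∀ l → sign l * A l zero * det (minor l A) ≈ β * b l + γ * c′ l
    term l with l ≟ i
    ... | yes ≡.refl = begin
      sign l * A l zero * det (minor l A)
        ≈⟨ *-cong (*-congˡ (Aᵢ zero)) (det-cong (λ j t → A≋B _ (punchInᵢ≢i l j) (suc t))) ⟩
      sign l * (β * B l zero + γ * C l zero) * det (minor l B)
        ≈⟨ solve 6 (λ s β b γ c d → s :* (β :* b :+ γ :* c) :* d
                                   := β :* (s :* b :* d) :+ γ :* (s :* c :* d))
                 refl (sign l) β (B l zero) γ (C l zero) (det (minor l B)) ⟩
      β * b l + γ * (sign l * C l zero * det (minor l B))
        ≈⟨ +-congˡ (*-congˡ (*-congˡ (det-cong (λ j t →
             trans (sym (A≋B _ (punchInᵢ≢i l j) (suc t))) (A≋C _ (punchInᵢ≢i l j) (suc t)))))) ⟩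
      β * b l + γ * c′ l ∎
    ... | no l≢i = begin
      sign l * A l zero * det (minor l A)
        ≈⟨ *-congˡ (det-linear i′ β γ minor≋B minor≋C minorᵢ) ⟩
      sign l * A l zero * (β * det (minor l B) + γ * det (minor l C))
        ≈⟨ solve 5 (λ x β d γ e → x :* (β :* d :+ γ :* e) := β :* (x :* d) :+ γ :* (x :* e))
                 refl (sign l * A l zero) β (det (minor l B)) γ (det (minor l C)) ⟩
      β * (sign l * A l zero * det (minor l B)) + γ * (sign l * A l zero * det (minor l C))
        ≈⟨ +-cong (*-congˡ (*-congʳ (*-congˡ (A≋B l l≢i zero))))
                  (*-congˡ (*-congʳ (*-congˡ (A≋C l l≢i zero)))) ⟩
      β * b l + γ * c′ l ∎
      where
      i′ : Fin n
      i′ = punchOut l≢i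
      punchIn≢i : ∀ j → j ≢ i′ → punchIn l j ≢ i
      punchIn≢i j j≢i′ eq = j≢i′ (punchIn-injective l j i′ (≡.trans eq (≡.sym (punchIn-punchOut l≢i))))
      minor≋B : ∀ j → j ≢ i′ → minor l A j ≋ minor l B j
      minor≋B j j≢i′ t = A≋B _ (punchIn≢i j j≢i′) (suc t)
      minor≋C : ∀ j → j ≢ i′ → minor l A j ≋ minor l C j
      minor≋C j j≢i′ t = A≋C _ (punchIn≢i j j≢i′) (suc t)
      minorᵢ : ∀ t → minor l A i′ t ≈ β * minor l B i′ t + γ * minor l C i′ t
      minorᵢ t rewrite punchIn-punchOut l≢i = Aᵢ (suc t)

  det-zeroRow : ∀ {n} (i : Fin n) {A : Matrix n} → (∀ t → A i t ≈ 0#) → det A ≈ 0#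
  det-zeroRow i {A} Aᵢ≈0 = begin
    det A                      ≈⟨ det-linear i 0# 0# (λ _ _ _ → refl) (λ _ _ _ → refl) Aᵢ≈0+0 ⟩
    0# * det A + 0# * det A    ≈⟨ +-cong (zeroˡ _) (zeroˡ _) ⟩
    0# + 0#                    ≈⟨ +-identityˡ 0# ⟩
    0#                         ∎
    where
    Aᵢ≈0+0 : ∀ t → A i t ≈ 0# * A i t + 0# * A i t
    Aᵢ≈0+0 t = trans (Aᵢ≈0 t) (sym (trans (+-cong (zeroˡ _) (zeroˡ _)) (+-identityˡ 0#)))

  sign-inject₁ : ∀ {n} (i : Fin n) → sign (inject₁ i) ≡ sign i
  sign-inject₁ zero    = ≡.refl
  sign-inject₁ (suc i) = ≡.cong -_ (sign-inject₁ i)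

  -- Rows other than a and a + 1 stay adjacent in the minor.
  punchIn-adjacent : ∀ {n} (l : Fin (ℕ.suc (ℕ.suc n))) (a : Fin (ℕ.suc n)) →
                     l ≢ inject₁ a → l ≢ suc a →
                     Σ (Fin n) λ a′ → punchIn l (inject₁ a′) ≡ inject₁ a × punchIn l (suc a′) ≡ suc a
  punchIn-adjacent zero zero l≢a _ = ⊥-elim (l≢a ≡.refl)
  punchIn-adjacent {ℕ.suc n} zero (suc a) _ _ = a , ≡.refl , ≡.refl
  punchIn-adjacent (suc zero) zero _ l≢a+1 = ⊥-elim (l≢a+1 ≡.refl)
  punchIn-adjacent {ℕ.suc n} (suc (suc l)) zero _ _ = zero , ≡.refl , ≡.refl
  punchIn-adjacent {ℕ.suc n} (suc l) (suc a) l≢a l≢a+1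
    with punchIn-adjacent l a (l≢a ∘ ≡.cong suc) (l≢a+1 ∘ ≡.cong suc)
  ... | a′ , eq₁ , eq₂ = suc a′ , ≡.cong suc eq₁ , ≡.cong suc eq₂

  punchIn-around-adjacent : ∀ {n} (a j : Fin (ℕ.suc n)) →
    punchIn (inject₁ a) j ≡ punchIn (suc a) j ⊎
    (punchIn (inject₁ a) j ≡ suc a × punchIn (suc a) j ≡ inject₁ a)
  punchIn-around-adjacent zero    zero    = inj₂ (≡.refl , ≡.refl)
  punchIn-around-adjacent zero    (suc j) = inj₁ ≡.refl
  punchIn-around-adjacent {ℕ.suc n} (suc a) zero = inj₁ ≡.refl
  punchIn-around-adjacent {ℕ.suc n} (suc a) (suc j) with punchIn-around-adjacent a j
  ... | inj₁ eq          = inj₁ (≡.cong suc eq)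
  ... | inj₂ (eq₁ , eq₂) = inj₂ (≡.cong suc eq₁ , ≡.cong suc eq₂)

  inject₁≢suc : ∀ {n} (i : Fin n) → inject₁ i ≢ suc i
  inject₁≢suc (suc i) eq = inject₁≢suc i (suc-injective eq)

  det-adjacentRows : ∀ {n} (a : Fin n) (A : Matrix (ℕ.suc n)) →
                     A (inject₁ a) ≋ A (suc a) → det A ≈ 0#
  det-adjacentRows {ℕ.suc n} a A rows≋ = begin
    det A                                ≈⟨ sum-pair term (inject₁≢suc a) other≈0 ⟩
    term (inject₁ a) + term (suc a)      ≈⟨ +-congˡ term-a+1 ⟩
    term (inject₁ a) - term (inject₁ a)  ≈⟨ -‿inverseʳ _ ⟩
    0#                                   ∎
    where
    term : Vector Carrier (ℕ.suc (ℕ.suc n))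
    term l = sign l * A l zero * det (minor l A)
    minors≋ : ∀ j → minor (inject₁ a) A j ≋ minor (suc a) A j
    minors≋ j t with punchIn-around-adjacent a j
    ... | inj₁ eq          = ≋-reflexive (≡.cong A eq) (suc t)
    ... | inj₂ (eq₁ , eq₂) = begin
      A (punchIn (inject₁ a) j) (suc t) ≡⟨ ≡.cong (λ r → A r (suc t)) eq₁ ⟩
      A (suc a) (suc t)                 ≈⟨ sym (rows≋ (suc t)) ⟩
      A (inject₁ a) (suc t)             ≡⟨ ≡.cong (λ r → A r (suc t)) (≡.sym eq₂) ⟩
      A (punchIn (suc a) j) (suc t)     ∎
    term-a+1 : term (suc a) ≈ - term (inject₁ a)
    term-a+1 = begin
      - sign a * A (suc a) zero * det (minor (suc a) A)
        ≈⟨ *-cong (*-cong (-‿cong (reflexive (≡.sym (sign-inject₁ a)))) (sym (rows≋ zero)))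
                  (sym (det-cong minors≋)) ⟩
      - sign (inject₁ a) * A (inject₁ a) zero * det (minor (inject₁ a) A)
        ≈⟨ *-congʳ (sym (-‿distribˡ-* _ _)) ⟩
      - (sign (inject₁ a) * A (inject₁ a) zero) * det (minor (inject₁ a) A)
        ≈⟨ sym (-‿distribˡ-* _ _) ⟩
      - term (inject₁ a) ∎
    other≈0 : ∀ l → l ≢ inject₁ a → l ≢ suc a → term l ≈ 0#
    other≈0 l l≢a l≢a+1 with punchIn-adjacent l a l≢a l≢a+1
    ... | a′ , eq₁ , eq₂ = trans (*-congˡ (det-adjacentRows a′ (minor l A) minor-rows≋)) (zeroʳ _)
      where
      minor-rows≋ : minor l A (inject₁ a′) ≋ minor l A (suc a′)
      minor-rows≋ t = begin
        A (punchIn l (inject₁ a′)) (suc t) ≡⟨ ≡.cong (λ r → A r (suc t)) eq₁ ⟩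
        A (inject₁ a) (suc t)              ≈⟨ rows≋ (suc t) ⟩
        A (suc a) (suc t)                  ≡⟨ ≡.cong (λ r → A r (suc t)) (≡.sym eq₂) ⟩
        A (punchIn l (suc a′)) (suc t)     ∎

  det-additive : ∀ {n} (i : Fin n) {A B C : Matrix n} →
                 (∀ j → j ≢ i → A j ≋ B j) → (∀ j → j ≢ i → A j ≋ C j) →
                 (∀ t → A i t ≈ B i t + C i t) → det A ≈ det B + det C
  det-additive i A≋B A≋C Aᵢ =
    trans (det-linear i 1# 1# A≋B A≋C (λ t → trans (Aᵢ t) (sym (+-cong (*-identityˡ _) (*-identityˡ _)))))
          (+-cong (*-identityˡ _) (*-identityˡ _))

  withRows : ∀ {n} → Matrix n → Fin n → Fin n → Vector Carrier n → Vector Carrier n → Matrix n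
  withRows A i j p q l with l ≟ i | l ≟ j
  ... | yes _ | _     = p
  ... | no _  | yes _ = q
  ... | no _  | no _  = A l

  module _ {n} (A : Matrix n) {i j : Fin n} (i≢j : i ≢ j) where

    withRows-i : ∀ p q → withRows A i j p q i ≡ p
    withRows-i p q with i ≟ i
    ... | yes _  = ≡.refl
    ... | no i≢i = ⊥-elim (i≢i ≡.refl)

    withRows-j : ∀ p q → withRows A i j p q j ≡ q
    withRows-j p q with j ≟ i | j ≟ j
    ... | yes j≡i | _      = ⊥-elim (i≢j (≡.sym j≡i))
    ... | no _    | yes _  = ≡.refl
    ... | no _    | no j≢j = ⊥-elim (j≢j ≡.refl)

    withRows-other : ∀ p q l → l ≢ i → l ≢ j → withRows A i j p q l ≡ A l
    withRows-other p q l l≢i l≢j with l ≟ i | l ≟ j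
    ... | yes l≡i | _       = ⊥-elim (l≢i l≡i)
    ... | no _    | yes l≡j = ⊥-elim (l≢j l≡j)
    ... | no _    | no _    = ≡.refl

    withRows-self : ∀ l → withRows A i j (A i) (A j) l ≡ A l
    withRows-self l with l ≟ i | l ≟ j
    ... | yes ≡.refl | _          = ≡.refl
    ... | no _       | yes ≡.refl = ≡.refl
    ... | no _       | no _       = ≡.refl

    withRows-offˡ : ∀ p p′ q l → l ≢ i → withRows A i j p q l ≡ withRows A i j p′ q l
    withRows-offˡ p p′ q l l≢i with l ≟ i | l ≟ j
    ... | yes l≡i | _     = ⊥-elim (l≢i l≡i)
    ... | no _    | yes _ = ≡.refl
    ... | no _    | no _  = ≡.refl

    withRows-offʳ : ∀ p q q′ l → l ≢ j → withRows A i j p q l ≡ withRows A i j p q′ l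
    withRows-offʳ p q q′ l l≢j with l ≟ i | l ≟ j
    ... | yes _ | _       = ≡.refl
    ... | no _  | yes l≡j = ⊥-elim (l≢j l≡j)
    ... | no _  | no _    = ≡.refl

    -- Bilinearity in rows i and j, with the alternating property, forces antisymmetry.
    det-swap : (∀ B → B i ≋ B j → det B ≈ 0#) → det (withRows A i j (A j) (A i)) ≈ - det A
    det-swap alternating = +-inverseˡ-unique _ _ (begin
      f b a + det A   ≈⟨ +-comm _ _ ⟩
      det A + f b a   ≈⟨ +-cong (sym (det-cong (λ l → ≋-reflexive (withRows-self l))))
                                (sym (+-identityʳ _)) ⟩
      f a b + (f b a + 0#)
                      ≈⟨ sym (+-cong (+-identityˡ _) (+-congˡ (f-diagonal b))) ⟩
      (0# + f a b) + (f b a + f b b)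
                      ≈⟨ sym (+-cong (+-congʳ (f-diagonal a)) refl) ⟩
      (f a a + f a b) + (f b a + f b b)
                      ≈⟨ sym (+-cong (f-additiveʳ a a b) (f-additiveʳ b a b)) ⟩
      f a s + f b s   ≈⟨ sym (f-additiveˡ a b s) ⟩
      f s s           ≈⟨ f-diagonal s ⟩
      0#              ∎)
      where
      a b s : Vector Carrier n
      a = A i
      b = A j
      s t = a t + b t
      f : Vector Carrier n → Vector Carrier n → Carrier
      f p q = det (withRows A i j p q)
      f-diagonal : ∀ p → f p p ≈ 0#
      f-diagonal p = alternating _ (≋-reflexive (≡.trans (withRows-i p p) (≡.sym (withRows-j p p))))
      f-additiveˡ : ∀ p p′ q → f (λ t → p t + p′ t) q ≈ f p q + f p′ q
      f-additiveˡ p p′ q = det-additive i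
        (λ l l≢i → ≋-reflexive (withRows-offˡ _ _ q l l≢i))
        (λ l l≢i → ≋-reflexive (withRows-offˡ _ _ q l l≢i))
        (λ t → trans (≋-reflexive (withRows-i _ q) t)
                     (sym (+-cong (≋-reflexive (withRows-i p q) t) (≋-reflexive (withRows-i p′ q) t))))
      f-additiveʳ : ∀ p q q′ → f p (λ t → q t + q′ t) ≈ f p q + f p q′
      f-additiveʳ p q q′ = det-additive j
        (λ l l≢j → ≋-reflexive (withRows-offʳ p _ _ l l≢j))
        (λ l l≢j → ≋-reflexive (withRows-offʳ p _ _ l l≢j))
        (λ t → trans (≋-reflexive (withRows-j p _) t)
                     (sym (+-cong (≋-reflexive (withRows-j p q) t) (≋-reflexive (withRows-j p q′) t))))

  det-equalRows-apart : ∀ d {n} {i j : Fin n} → ℕ.suc (toℕ i ℕ.+ d) ≡ toℕ j →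
                        (A : Matrix n) → A i ≋ A j → det A ≈ 0#
  det-equalRows-apart ℕ.zero {i = i} {suc a} i+1≡j A Aᵢ≋Aⱼ =
    det-adjacentRows a A (λ t → trans (≋-reflexive (≡.cong A (≡.sym i≡a)) t) (Aᵢ≋Aⱼ t))
    where
    i≡a : i ≡ inject₁ a
    i≡a = toℕ-injective (≡.trans (≡.sym (NP.+-identityʳ (toℕ i)))
                                 (≡.trans (NP.suc-injective i+1≡j) (≡.sym (toℕ-inject₁ a))))
  det-equalRows-apart (ℕ.suc d) {i = i} {suc a} i+d+2≡j A Aᵢ≋Aⱼ = begin
    det A        ≈⟨ sym (-‿involutive _) ⟩
    - (- det A)  ≈⟨ -‿cong (sym (det-swap A (inject₁≢suc a) (det-adjacentRows a))) ⟩
    - det A′     ≈⟨ -‿cong (det-equalRows-apart d i+d+1≡k A′ A′ᵢ≋A′ₖ) ⟩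
    - 0#         ≈⟨ -0#≈0# ⟩
    0#           ∎
    where
    k : Fin _
    k = inject₁ a
    A′ : Matrix _
    A′ = withRows A k (suc a) (A (suc a)) (A k)
    i+d+1≡k : ℕ.suc (toℕ i ℕ.+ d) ≡ toℕ k
    i+d+1≡k = ≡.trans (≡.sym (NP.+-suc (toℕ i) d))
                      (≡.trans (NP.suc-injective i+d+2≡j) (≡.sym (toℕ-inject₁ a)))
    i≢k : i ≢ k
    i≢k i≡k = NP.m≢1+m+n (toℕ i) (≡.trans (≡.cong toℕ i≡k) (≡.sym i+d+1≡k))
    i≢j : i ≢ suc a
    i≢j i≡j = NP.m≢1+m+n (toℕ i) (≡.trans (≡.cong toℕ i≡j) (≡.sym i+d+2≡j))
    A′ᵢ≋A′ₖ : A′ i ≋ A′ k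
    A′ᵢ≋A′ₖ t = begin
      A′ i t       ≡⟨ ≡.cong (λ r → r t) (withRows-other A (inject₁≢suc a) _ _ i i≢k i≢j) ⟩
      A i t        ≈⟨ Aᵢ≋Aⱼ t ⟩
      A (suc a) t  ≡⟨ ≡.cong (λ r → r t) (≡.sym (withRows-i A (inject₁≢suc a) _ _)) ⟩
      A′ k t       ∎

  det-equalRows : ∀ {n} {i j : Fin n} → i ≢ j → (A : Matrix n) → A i ≋ A j → det A ≈ 0#
  det-equalRows {i = i} {j} i≢j A Aᵢ≋Aⱼ with NP.<-cmp (toℕ i) (toℕ j)
  ... | tri< i<j _ _ = det-equalRows-apart _ (proj₂ (NP.m≤n⇒∃[o]m+o≡n i<j)) A Aᵢ≋Aⱼ
  ... | tri≈ _ i≡j _ = ⊥-elim (i≢j (toℕ-injective i≡j))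
  ... | tri> _ _ j<i = det-equalRows-apart _ (proj₂ (NP.m≤n⇒∃[o]m+o≡n j<i)) A (λ t → sym (Aᵢ≋Aⱼ t))

  replaceRow : ∀ {n} → Matrix n → Fin n → Vector Carrier n → Matrix n
  replaceRow A i r = updateAt A i (const r)

  replaceRow-i : ∀ {n} (A : Matrix n) i r → replaceRow A i r i ≋ r
  replaceRow-i A i r = ≋-reflexive (updateAt-updates i A)

  replaceRow-other : ∀ {n} (A : Matrix n) {i} r j → j ≢ i → replaceRow A i r j ≋ A j
  replaceRow-other A {i} r j j≢i = ≋-reflexive (updateAt-minimal j i A j≢i)

  det-replaceRow-sum : ∀ {n m} (A : Matrix n) i (b : Vector Carrier m) (r : Fin m → Vector Carrier n) →
                       det (replaceRow A i (λ t → sum (λ j → b j * r j t)))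
                       ≈ sum (λ j → b j * det (replaceRow A i (r j)))
  det-replaceRow-sum {m = ℕ.zero} A i b r = det-zeroRow i (replaceRow-i A i _)
  det-replaceRow-sum {m = ℕ.suc m} A i b r = begin
    det (replaceRow A i (λ t → sum (λ j → b j * r j t)))
      ≈⟨ det-linear i (b zero) 1# (same-off-i (r zero)) (same-off-i rest) rowᵢ ⟩
    b zero * det (replaceRow A i (r zero)) + 1# * det (replaceRow A i rest)
      ≈⟨ +-congˡ (trans (*-identityˡ _) (det-replaceRow-sum A i (b ∘ suc) (r ∘ suc))) ⟩
    sum (λ j → b j * det (replaceRow A i (r j))) ∎
    where
    rest : Vector Carrier _
    rest t = sum (λ j → b (suc j) * r (suc j) t)
    same-off-i : ∀ r′ j → j ≢ i → replaceRow A i (λ t → sum (λ j → b j * r j t)) j ≋ replaceRow A i r′ j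
    same-off-i r′ j j≢i t = trans (replaceRow-other A _ j j≢i t) (sym (replaceRow-other A r′ j j≢i t))
    rowᵢ : ∀ t → replaceRow A i (λ t → sum (λ j → b j * r j t)) i t
                 ≈ b zero * replaceRow A i (r zero) i t + 1# * replaceRow A i rest i t
    rowᵢ t = trans (replaceRow-i A i _ t)
                   (sym (+-cong (*-congˡ (replaceRow-i A i _ t))
                                (trans (*-identityˡ _) (replaceRow-i A i rest t))))

  leftKernel*det≈0 : ∀ {n} (A : Matrix n) (b : Vector Carrier n) →
                     (∀ t → sum (λ j → b j * A j t) ≈ 0#) → ∀ i → b i * det A ≈ 0#
  leftKernel*det≈0 A b bA≈0 i = begin
    b i * det A
      ≈⟨ *-congˡ (sym (det-cong (λ l → ≋-reflexive (updateAt-id-local i A ≡.refl l)))) ⟩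
    b i * det (replaceRow A i (A i))
      ≈⟨ sym (sum-single _ i (λ j j≢i → trans (*-congˡ (equalRows j j≢i)) (zeroʳ _))) ⟩
    sum (λ j → b j * det (replaceRow A i (A j)))
      ≈⟨ sym (det-replaceRow-sum A i b A) ⟩
    det (replaceRow A i (λ t → sum (λ j → b j * A j t)))
      ≈⟨ det-zeroRow i (λ t → trans (replaceRow-i A i _ t) (bA≈0 t)) ⟩
    0# ∎
    where
    equalRows : ∀ j → j ≢ i → det (replaceRow A i (A j)) ≈ 0#
    equalRows j j≢i = det-equalRows (j≢i ∘ ≡.sym) _ (λ t →
      trans (replaceRow-i A i (A j) t) (sym (replaceRow-other A (A j) j j≢i t)))

  module _ {n} (A : Matrix n) (p : Fin n) (μ : Vector Carrier n) (μₚ≈0 : μ p ≈ 0#) where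

    private
      truncate : ℕ → Vector Carrier n
      truncate s l with toℕ l ℕ.<? s
      ... | yes _ = μ l
      ... | no _  = 0#

      truncate-step : ∀ s l → toℕ l ≢ s → truncate (ℕ.suc s) l ≈ truncate s l
      truncate-step s l l≢s with toℕ l ℕ.<? ℕ.suc s | toℕ l ℕ.<? s
      ... | yes _  | yes _  = refl
      ... | no _   | no _   = refl
      ... | yes l≤s | no l≮s = ⊥-elim (l≮s (NP.≤∧≢⇒< (ℕ.s≤s⁻¹ l≤s) l≢s))
      ... | no l≮s+1 | yes l<s = ⊥-elim (l≮s+1 (NP.m≤n⇒m≤1+n l<s))

      truncate-p : ∀ s → truncate s p ≈ 0#
      truncate-p s with toℕ p ℕ.<? s
      ... | yes _ = μₚ≈0
      ... | no _  = refl

      -- Only the rows of index below s are modified, so s can grow one row at a time.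
      reduced : ℕ → Matrix n
      reduced s l t = A l t + truncate s l * A p t

      reduced-p : ∀ s → reduced s p ≋ A p
      reduced-p s t = trans (+-congˡ (trans (*-congʳ (truncate-p s)) (zeroˡ _))) (+-identityʳ _)

      det-reduced-suc : ∀ s → s < n → det (reduced (ℕ.suc s)) ≈ det (reduced s)
      det-reduced-suc s s<n = begin
        det (reduced (ℕ.suc s))              ≈⟨ det-linear l₀ 1# (μ l₀) off-l₀ off-l₀′ row-l₀ ⟩
        1# * det (reduced s) + μ l₀ * det C  ≈⟨ +-cong (*-identityˡ _) μdetC≈0 ⟩
        det (reduced s) + 0#                 ≈⟨ +-identityʳ _ ⟩
        det (reduced s)                      ∎
        where
        l₀ : Fin n
        l₀ = fromℕ< s<n
        C : Matrix n
        C = replaceRow (reduced s) l₀ (A p)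
        l₀≡s : toℕ l₀ ≡ s
        l₀≡s = toℕ-fromℕ< s<n
        off-l₀ : ∀ j → j ≢ l₀ → reduced (ℕ.suc s) j ≋ reduced s j
        off-l₀ j j≢l₀ t = +-congˡ (*-congʳ (truncate-step s j
          (λ j≡s → j≢l₀ (toℕ-injective (≡.trans j≡s (≡.sym l₀≡s))))))
        off-l₀′ : ∀ j → j ≢ l₀ → reduced (ℕ.suc s) j ≋ C j
        off-l₀′ j j≢l₀ t = trans (off-l₀ j j≢l₀ t) (sym (replaceRow-other (reduced s) _ j j≢l₀ t))
        truncate-l₀ : truncate (ℕ.suc s) l₀ ≈ μ l₀ × truncate s l₀ ≈ 0#
        truncate-l₀ with toℕ l₀ ℕ.<? ℕ.suc s | toℕ l₀ ℕ.<? s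
        ... | yes _     | no _     = refl , refl
        ... | no l₀≮s+1 | _        = ⊥-elim (l₀≮s+1 (NP.≤-reflexive (≡.cong ℕ.suc l₀≡s)))
        ... | _         | yes l₀<s = ⊥-elim (NP.<-irrefl l₀≡s l₀<s)
        row-l₀ : ∀ t → reduced (ℕ.suc s) l₀ t ≈ 1# * reduced s l₀ t + μ l₀ * C l₀ t
        row-l₀ t = begin
          A l₀ t + truncate (ℕ.suc s) l₀ * A p t
            ≈⟨ +-cong (sym (+-identityʳ _)) (*-congʳ (proj₁ truncate-l₀)) ⟩
          (A l₀ t + 0#) + μ l₀ * A p t
            ≈⟨ +-cong (+-congˡ (sym (trans (*-congʳ (proj₂ truncate-l₀)) (zeroˡ _))))
                      (*-congˡ (sym (replaceRow-i (reduced s) l₀ (A p) t))) ⟩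
          reduced s l₀ t + μ l₀ * C l₀ t
            ≈⟨ +-congʳ (sym (*-identityˡ _)) ⟩
          1# * reduced s l₀ t + μ l₀ * C l₀ t ∎
        μdetC≈0 : μ l₀ * det C ≈ 0#
        μdetC≈0 with l₀ ≟ p
        ... | yes ≡.refl = trans (*-congʳ μₚ≈0) (zeroˡ _)
        ... | no l₀≢p = trans (*-congˡ (det-equalRows l₀≢p C rows≋)) (zeroʳ _)
          where
          rows≋ : C l₀ ≋ C p
          rows≋ t = trans (replaceRow-i (reduced s) l₀ (A p) t)
                          (sym (trans (replaceRow-other (reduced s) _ p (l₀≢p ∘ ≡.sym) t) (reduced-p s t)))

      det-reduced : ∀ s → det (reduced s) ≈ det A
      det-reduced ℕ.zero =
        det-cong (λ l t → trans (+-congˡ (trans (*-congʳ (truncate-zero l)) (zeroˡ _))) (+-identityʳ _))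
        where
        truncate-zero : ∀ l → truncate 0 l ≈ 0#
        truncate-zero l with toℕ l ℕ.<? 0
        ... | no _ = refl
      det-reduced (ℕ.suc s) with s ℕ.<? n
      ... | yes s<n = trans (det-reduced-suc s s<n) (det-reduced s)
      ... | no s≮n  = trans (det-cong (λ l t → +-congˡ (*-congʳ (truncate-step s l (l≢s l))))) (det-reduced s)
        where
        l≢s : ∀ l → toℕ l ≢ s
        l≢s l ≡.refl = s≮n (toℕ<n l)

    det-addRowMultiples : det (λ l t → A l t + μ l * A p t) ≈ det A
    det-addRowMultiples = trans (det-cong (λ l t → +-congˡ (*-congʳ (truncate-all l)))) (det-reduced n)
      where
      truncate-all : ∀ l → μ l ≈ truncate n l
      truncate-all l with toℕ l ℕ.<? n
      ... | yes _   = refl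
      ... | no l≮n  = ⊥-elim (l≮n (toℕ<n l))

  sign² : ∀ {n} (i : Fin n) → sign i * sign i ≈ 1#
  sign² zero    = *-identityˡ 1#
  sign² (suc i) = trans (sym (-‿distribˡ-* _ _)) (trans (-‿cong (sym (-‿distribʳ-* _ _)))
                        (trans (-‿involutive _) (sign² i)))

  det-pivot : ∀ {n} (A : Matrix (ℕ.suc n)) p → (∀ l → l ≢ p → A l zero ≈ 0#) →
              det A ≈ sign p * A p zero * det (minor p A)
  det-pivot A p column≈0 = sum-single (λ l → sign l * A l zero * det (minor l A)) p (λ l l≢p →
    trans (*-congʳ (trans (*-congˡ (column≈0 l l≢p)) (zeroʳ _))) (zeroˡ _))

¬¬-∀-Fin : ∀ {p} n {P : Fin n → Set p} → (∀ i → ¬ ¬ P i) → ¬ ¬ (∀ i → P i)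
¬¬-∀-Fin ℕ.zero    _    ¬∀P = ¬∀P (λ ())
¬¬-∀-Fin (ℕ.suc n) ¬¬P ¬∀P = ¬¬P zero λ P₀ → ¬¬-∀-Fin n (¬¬P ∘ suc) λ P₊ → ¬∀P λ where
  zero    → P₀
  (suc i) → P₊ i

module LinearAlgebra {c ℓ : Level} (𝔽 : Field c ℓ) where
  open Field 𝔽 hiding (zero)
  open FieldDefs 𝔽
  open Determinant commutativeRing
  open import Algebra.Properties.Ring ring using (-‿distribˡ-*)
  open import Algebra.Properties.Semiring.Sum semiring using (sum; ∑-comm; *-distribˡ-sum; sum-cong-≋)
  open import Algebra.Properties.CommutativeSemigroup *-commutativeSemigroup using (x∙yz≈y∙xz)
  open import Algebra.Solver.Ring.NaturalCoefficients.Default commutativeSemiring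
    using (solve; _:+_; _:*_; _:=_)
  open import Relation.Binary.Reasoning.Setoid setoid

  sumF≡sum : ∀ n (f : Vect n) → sumF n f ≡ sum f
  sumF≡sum ℕ.zero    f = ≡.refl
  sumF≡sum (ℕ.suc n) f = ≡.cong (f zero +_) (sumF≡sum n (f ∘ suc))

  sumF-cong : ∀ {n} {f g : Vect n} → (∀ i → f i ≈ g i) → sumF n f ≈ sumF n g
  sumF-cong {n} f≈g =
    trans (reflexive (sumF≡sum n _)) (trans (sum-cong-≋ f≈g) (reflexive (≡.sym (sumF≡sum n _))))

  sumF-≈0 : ∀ {n} {f : Vect n} → (∀ i → f i ≈ 0#) → sumF n f ≈ 0#
  sumF-≈0 {n} f≈0 = trans (reflexive (sumF≡sum n _)) (sum-≈0 f≈0)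

  transpose : ∀ {n} → Matrix n → Matrix n
  transpose A i j = A j i

  x*y≈1∧x*z≈0⇒z≈0 : ∀ {x y z} → x * y ≈ 1# → x * z ≈ 0# → z ≈ 0#
  x*y≈1∧x*z≈0⇒z≈0 {x} {y} {z} xy≈1 xz≈0 = begin
    z             ≈⟨ sym (*-identityˡ z) ⟩
    1# * z        ≈⟨ *-congʳ (sym xy≈1) ⟩
    x * y * z     ≈⟨ solve 3 (λ x y z → x :* y :* z := y :* (x :* z)) refl x y z ⟩
    y * (x * z)   ≈⟨ *-congˡ xz≈0 ⟩
    y * 0#        ≈⟨ zeroʳ y ⟩
    0#            ∎

  sumF-linear : ∀ {n} (a x y : Vect n) (μ : Carrier) →
                sumF n (λ j → a j * (x j + μ * y j))
                ≈ sumF n (λ j → a j * x j) + μ * sumF n (λ j → a j * y j)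
  sumF-linear {ℕ.zero}  a x y μ = sym (trans (+-congˡ (zeroʳ μ)) (+-identityʳ 0#))
  sumF-linear {ℕ.suc n} a x y μ = begin
    a zero * (x zero + μ * y zero) + sumF n (λ j → a (suc j) * (x (suc j) + μ * y (suc j)))
      ≈⟨ +-congˡ (sumF-linear (a ∘ suc) (x ∘ suc) (y ∘ suc) μ) ⟩
    a zero * (x zero + μ * y zero) + (X + μ * Y)
      ≈⟨ solve 6 (λ a x μ y X Y → a :* (x :+ μ :* y) :+ (X :+ μ :* Y)
                                 := (a :* x :+ X) :+ μ :* (a :* y :+ Y))
               refl (a zero) (x zero) μ (y zero) X Y ⟩
    (a zero * x zero + X) + μ * (a zero * y zero + Y) ∎
    where
    X Y : Carrier
    X = sumF n (λ j → a (suc j) * x (suc j))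
    Y = sumF n (λ j → a (suc j) * y (suc j))

  module Elimination {n} (A : Matrix (ℕ.suc n)) (p : Fin (ℕ.suc n))
                     {ι : Carrier} (ι-inverse : A p zero * ι ≈ 1#) where

    μ : Vector Carrier (ℕ.suc n)
    μ l with l ≟ p
    ... | yes _ = 0#
    ... | no _  = - (A l zero * ι)

    μ-p : μ p ≈ 0#
    μ-p with p ≟ p
    ... | yes _   = refl
    ... | no p≢p = ⊥-elim (p≢p ≡.refl)

    μ-other : ∀ {l} → l ≢ p → μ l ≈ - (A l zero * ι)
    μ-other {l} l≢p with l ≟ p
    ... | yes l≡p = ⊥-elim (l≢p l≡p)
    ... | no _    = refl

    pivot-cancel : ∀ x → x * ι * A p zero ≈ x
    pivot-cancel x = begin
      x * ι * A p zero    ≈⟨ solve 3 (λ x ι a → x :* ι :* a := x :* (a :* ι)) refl x ι (A p zero) ⟩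
      x * (A p zero * ι)  ≈⟨ *-congˡ ι-inverse ⟩
      x * 1#              ≈⟨ *-identityʳ x ⟩
      x                   ∎

    cleared : Matrix (ℕ.suc n)
    cleared l t = A l t + μ l * A p t

    det-cleared : det cleared ≈ det A
    det-cleared = det-addRowMultiples A p μ μ-p

    cleared-p : ∀ t → cleared p t ≈ A p t
    cleared-p t = trans (+-congˡ (trans (*-congʳ μ-p) (zeroˡ _))) (+-identityʳ _)

    cleared-column : ∀ l → l ≢ p → cleared l zero ≈ 0#
    cleared-column l l≢p = begin
      A l zero + μ l * A p zero              ≈⟨ +-congˡ (*-congʳ (μ-other l≢p)) ⟩
      A l zero + - (A l zero * ι) * A p zero ≈⟨ +-congˡ (sym (-‿distribˡ-* _ _)) ⟩
      A l zero - A l zero * ι * A p zero     ≈⟨ +-congˡ (-‿cong (pivot-cancel (A l zero))) ⟩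
      A l zero - A l zero                    ≈⟨ -‿inverseʳ _ ⟩
      0#                                     ∎

    minor-cleared-independent : LinearIndependent (transpose A) →
                                LinearIndependent (transpose (minor p cleared))
    minor-cleared-independent independent a′ a′cleared≈0 j = independent a a·A≈0 (suc j)
      where
      S : Fin (ℕ.suc n) → Carrier
      S l = sumF n (λ j → a′ j * A l (suc j))
      -- the first coordinate is chosen so that the pivot row is annihilated
      a : Vector Carrier (ℕ.suc n)
      a zero    = - (S p * ι)
      a (suc j) = a′ j
      a·A≈0 : ∀ l → a zero * A l zero + S l ≈ 0#
      a·A≈0 l with l ≟ p
      ... | yes ≡.refl = begin
        - (S l * ι) * A l zero + S l  ≈⟨ +-congʳ (sym (-‿distribˡ-* _ _)) ⟩
        - (S l * ι * A l zero) + S l  ≈⟨ +-congʳ (-‿cong (pivot-cancel (S l))) ⟩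
        - S l + S l                   ≈⟨ -‿inverseˡ _ ⟩
        0#                            ∎
      ... | no l≢p = begin
        - (S p * ι) * A l zero + S l  ≈⟨ +-congʳ (sym (-‿distribˡ-* _ _)) ⟩
        - (S p * ι * A l zero) + S l  ≈⟨ +-congʳ (-‿cong (solve 3 (λ s ι a → s :* ι :* a := a :* ι :* s)
                                                                 refl (S p) ι (A l zero))) ⟩
        - (A l zero * ι * S p) + S l  ≈⟨ +-congʳ (-‿distribˡ-* _ _) ⟩
        - (A l zero * ι) * S p + S l  ≈⟨ +-congʳ (*-congʳ (sym (μ-other l≢p))) ⟩
        μ l * S p + S l               ≈⟨ +-comm _ _ ⟩
        S l + μ l * S p               ≈⟨ sym (sumF-linear a′ (λ j → A l (suc j)) (λ j → A p (suc j)) (μ l)) ⟩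
        sumF n (λ j → a′ j * cleared l (suc j))
                                      ≡⟨ ≡.cong (λ r → sumF n (λ j → a′ j * cleared r (suc j))) (≡.sym l≡) ⟩
        sumF n (λ j → a′ j * cleared (punchIn p l′) (suc j))
                                      ≈⟨ a′cleared≈0 l′ ⟩
        0#                            ∎
        where
        l′ : Fin n
        l′ = punchOut (l≢p ∘ ≡.sym)
        l≡ : punchIn p l′ ≡ l
        l≡ = punchIn-punchOut (l≢p ∘ ≡.sym)

  independent⇒det≉0 : ∀ {n} (A : Matrix n) → LinearIndependent (transpose A) → ¬ det A ≈ 0#
  independent⇒det≉0 {ℕ.zero}  A _ 1≈0 = 0≉1 (sym 1≈0)
  independent⇒det≉0 {ℕ.suc n} A independent det≈0 = ¬¬-∀-Fin (ℕ.suc n) first-column≈0 first-column≉0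
    where
    first-column≉0 : ¬ (∀ l → A l zero ≈ 0#)
    first-column≉0 column≈0 = 0≉1 (sym (independent e₀ e₀·A≈0 zero))
      where
      e₀ : Vector Carrier (ℕ.suc n)
      e₀ zero    = 1#
      e₀ (suc _) = 0#
      e₀·A≈0 : ∀ l → 1# * A l zero + sumF n (λ j → 0# * A l (suc j)) ≈ 0#
      e₀·A≈0 l = trans (+-cong (trans (*-identityˡ _) (column≈0 l))
                               (sumF-≈0 {n} (λ j → zeroˡ (A l (suc j)))))
                       (+-identityˡ 0#)
    -- A nonzero pivot would make the cleared minor a smaller counterexample.
    first-column≈0 : ∀ p → ¬ ¬ (A p zero ≈ 0#)
    first-column≈0 p Aₚ≉0 =
      independent⇒det≉0 (minor p cleared) (minor-cleared-independent independent) det-minor≈0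
      where
      open Elimination A p (proj₂ (inverse _ Aₚ≉0))
      det-minor≈0 : det (minor p cleared) ≈ 0#
      det-minor≈0 = x*y≈1∧x*z≈0⇒z≈0 (proj₂ (inverse _ Aₚ≉0)) (x*y≈1∧x*z≈0⇒z≈0 (sign² p) (begin
        sign p * (A p zero * det (minor p cleared))      ≈⟨ sym (*-assoc _ _ _) ⟩
        sign p * A p zero * det (minor p cleared)        ≈⟨ *-congʳ (*-congˡ (sym (cleared-p zero))) ⟩
        sign p * cleared p zero * det (minor p cleared)  ≈⟨ sym (det-pivot cleared p cleared-column) ⟩
        det cleared                                      ≈⟨ det-cleared ⟩
        det A                                            ≈⟨ det≈0 ⟩
        0#                                               ∎))

  independent⇒kernel-trivial : ∀ {n} (Q : Matrix n) → LinearIndependent Q →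
    (b : Vector Carrier n) → (∀ l → sumF n (λ j → Q l j * b j) ≈ 0#) → ∀ j → b j ≈ 0#
  independent⇒kernel-trivial {n} Q independent b Qb≈0 j =
    x*y≈1∧x*z≈0⇒z≈0 (proj₂ (inverse _ det-Qᵀ≉0))
      (trans (*-comm _ _) (leftKernel*det≈0 (transpose Q) b bQᵀ≈0 j))
    where
    det-Qᵀ≉0 : ¬ det (transpose Q) ≈ 0#
    det-Qᵀ≉0 = independent⇒det≉0 (transpose Q) independent
    bQᵀ≈0 : ∀ t → sum (λ j → b j * Q t j) ≈ 0#
    bQᵀ≈0 t = trans (sum-cong-≋ (λ j → *-comm (b j) (Q t j)))
                    (trans (reflexive (≡.sym (sumF≡sum n (λ j → Q t j * b j)))) (Qb≈0 t))

  dot-span : ∀ {r n} (v : Vect n) (g : Fin r → Vect n) (a : Vect r) {w : Vect n} →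
             (∀ t → w t ≈ sumF r (λ j → a j * g j t)) → dot v w ≈ sumF r (λ j → a j * dot v (g j))
  dot-span {r} {n} v g a {w} w≈ = begin
    sumF n (λ t → v t * w t)
      ≡⟨ sumF≡sum n (λ t → v t * w t) ⟩
    sum (λ t → v t * w t)
      ≈⟨ sum-cong-≋ (λ t → trans (*-congˡ (trans (w≈ t) (reflexive (sumF≡sum r _))))
                                 (*-distribˡ-sum (v t) (λ j → a j * g j t))) ⟩
    sum (λ t → sum (λ j → v t * (a j * g j t)))
      ≈⟨ ∑-comm (λ t j → v t * (a j * g j t)) ⟩
    sum (λ j → sum (λ t → v t * (a j * g j t)))
      ≈⟨ sum-cong-≋ (λ j → trans (sum-cong-≋ (λ t → x∙yz≈y∙xz (v t) (a j) (g j t)))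
                                 (sym (*-distribˡ-sum (a j) (λ t → v t * g j t)))) ⟩
    sum (λ j → a j * sum (λ t → v t * g j t))
      ≈⟨ sum-cong-≋ (λ j → *-congˡ {a j} (reflexive (≡.sym (sumF≡sum n (λ t → v t * g j t))))) ⟩
    sum (λ j → a j * dot v (g j))
      ≡⟨ ≡.sym (sumF≡sum r (λ j → a j * dot v (g j))) ⟩
    sumF r (λ j → a j * dot v (g j)) ∎

module Convolution {c ℓ : Level} (𝔽 : Field c ℓ) where
  open Field 𝔽 hiding (zero)
  open FieldDefs 𝔽
  open LinearAlgebra 𝔽 using (sumF≡sum; sumF-cong)
  open import Algebra.Properties.Semiring.Sum semiring
    using (sum; sum-cong-≋; ∑-comm; *-distribˡ-sum; *-distribʳ-sum)
  open import Algebra.Properties.CommutativeSemigroup NP.+-commutativeSemigroup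
    using () renaming (x∙yz≈y∙xz to ℕ-x∙yz≈y∙xz)
  open import Relation.Binary.Reasoning.Setoid setoid

  sumℕ : ℕ → (ℕ → Carrier) → Carrier
  sumℕ n F = sumF n (F ∘ toℕ)

  sumℕ-cong : ∀ n {F G : ℕ → Carrier} → (∀ t → F t ≈ G t) → sumℕ n F ≈ sumℕ n G
  sumℕ-cong n F≈G = sumF-cong {n} (F≈G ∘ toℕ)

  sumℕ-≈0 : ∀ n {F : ℕ → Carrier} → (∀ t → t < n → F t ≈ 0#) → sumℕ n F ≈ 0#
  sumℕ-≈0 ℕ.zero    F≈0 = refl
  sumℕ-≈0 (ℕ.suc n) F≈0 =
    trans (+-cong (F≈0 0 (ℕ.s≤s ℕ.z≤n)) (sumℕ-≈0 n (λ t t<n → F≈0 (ℕ.suc t) (ℕ.s≤s t<n))))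
          (+-identityˡ 0#)

  sumℕ-+ : ∀ a b F → sumℕ (a ℕ.+ b) F ≈ sumℕ a F + sumℕ b (λ t → F (a ℕ.+ t))
  sumℕ-+ ℕ.zero    b F = sym (+-identityˡ _)
  sumℕ-+ (ℕ.suc a) b F = trans (+-congˡ (sumℕ-+ a b (F ∘ ℕ.suc))) (sym (+-assoc _ _ _))

  ext-toℕ : ∀ {n} (v : Vect n) (t : Fin n) → ext v (toℕ t) ≡ v t
  ext-toℕ {n} v t with toℕ t <? n
  ... | yes t<n = ≡.cong v (fromℕ<-toℕ t t<n)
  ... | no t≮n  = ⊥-elim (t≮n (toℕ<n t))

  ext-≥ : ∀ {n} (v : Vect n) t → n ≤ t → ext v t ≡ 0#
  ext-≥ {n} v t n≤t with t <? n
  ... | yes t<n = ⊥-elim (NP.<⇒≱ t<n n≤t)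
  ... | no _    = ≡.refl

  shiftedCoeff-< : ∀ {m} (p : Vect (ℕ.suc m)) n i → n < i → shiftedCoeff p n i ≡ 0#
  shiftedCoeff-< p n i n<i with i ≤? n
  ... | yes i≤n = ⊥-elim (NP.<⇒≱ n<i i≤n)
  ... | no _    = ≡.refl

  shiftedCoeff-+ : ∀ {m} (p : Vect (ℕ.suc m)) i t → shiftedCoeff p (i ℕ.+ t) i ≡ ext p t
  shiftedCoeff-+ p i t with i ≤? i ℕ.+ t
  ... | yes _    = ≡.cong (ext p) (NP.m+n∸m≡n i t)
  ... | no i≰i+t = ⊥-elim (i≰i+t (NP.m≤m+n i t))

  sumℕ-shiftedCoeff : ∀ {m} (p : Vect (ℕ.suc m)) i M (y : ℕ → Carrier) →
    sumℕ (i ℕ.+ M) (λ n → shiftedCoeff p n i * y n) ≈ sumℕ M (λ t → ext p t * y (i ℕ.+ t))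
  sumℕ-shiftedCoeff p i M y = begin
    sumℕ (i ℕ.+ M) (λ n → shiftedCoeff p n i * y n)
      ≈⟨ sumℕ-+ i M (λ n → shiftedCoeff p n i * y n) ⟩
    sumℕ i (λ n → shiftedCoeff p n i * y n) + sumℕ M (λ t → shiftedCoeff p (i ℕ.+ t) i * y (i ℕ.+ t))
      ≈⟨ +-cong (sumℕ-≈0 i (λ n n<i → trans (*-congʳ {y n} (reflexive (shiftedCoeff-< p n i n<i))) (zeroˡ _)))
                (sumℕ-cong M (λ t → *-congʳ {y (i ℕ.+ t)} (reflexive (shiftedCoeff-+ p i t)))) ⟩
    0# + sumℕ M (λ t → ext p t * y (i ℕ.+ t))
      ≈⟨ +-identityˡ _ ⟩
    sumℕ M (λ t → ext p t * y (i ℕ.+ t)) ∎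

  sumℕ-ext : ∀ {m} (p : Vect (ℕ.suc m)) r (y : ℕ → Carrier) →
    sumℕ (ℕ.suc m ℕ.+ r) (λ t → ext p t * y t) ≈ dot p (y ∘ toℕ)
  sumℕ-ext {m} p r y = begin
    sumℕ (ℕ.suc m ℕ.+ r) (λ t → ext p t * y t)
      ≈⟨ sumℕ-+ (ℕ.suc m) r (λ t → ext p t * y t) ⟩
    sumℕ (ℕ.suc m) (λ t → ext p t * y t) + sumℕ r (λ u → ext p (ℕ.suc m ℕ.+ u) * y (ℕ.suc m ℕ.+ u))
      ≈⟨ +-cong (sumF-cong (λ t → *-congʳ {y (toℕ t)} (reflexive (ext-toℕ p t))))
                (sumℕ-≈0 r (λ u _ → trans (*-congʳ {y (ℕ.suc m ℕ.+ u)}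
                                             (reflexive (ext-≥ p (ℕ.suc m ℕ.+ u) (NP.m≤m+n (ℕ.suc m) u))))
                                          (zeroˡ _))) ⟩
    dot p (y ∘ toℕ) + 0#
      ≈⟨ +-identityʳ _ ⟩
    dot p (y ∘ toℕ) ∎

  dot-shifted≈dot-window : ∀ m k (P : Vect (ℕ.suc m)) (x : Vect (ℕ.suc (m ℕ.+ k))) (i : Fin (ℕ.suc k)) →
    sum (λ n → shiftedCoeff P (toℕ n) (toℕ i) * x n) ≈ dot P (window {m} {k} x i)
  dot-shifted≈dot-window m k P x i = begin
    sum (λ n → shiftedCoeff P (toℕ n) (toℕ i) * x n)
      ≡⟨ ≡.sym (sumF≡sum _ (λ n → shiftedCoeff P (toℕ n) (toℕ i) * x n)) ⟩
    sumF (ℕ.suc (m ℕ.+ k)) (λ n → shiftedCoeff P (toℕ n) (toℕ i) * x n)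
      ≈⟨ sumF-cong (λ n → *-congˡ {shiftedCoeff P (toℕ n) (toℕ i)} (reflexive (≡.sym (ext-toℕ x n)))) ⟩
    sumℕ (ℕ.suc (m ℕ.+ k)) (λ n → shiftedCoeff P n (toℕ i) * ext x n)
      ≡⟨ ≡.cong (λ N → sumℕ N (λ n → shiftedCoeff P n (toℕ i) * ext x n)) length≡ ⟩
    sumℕ (toℕ i ℕ.+ (ℕ.suc m ℕ.+ r)) (λ n → shiftedCoeff P n (toℕ i) * ext x n)
      ≈⟨ sumℕ-shiftedCoeff P (toℕ i) (ℕ.suc m ℕ.+ r) (ext x) ⟩
    sumℕ (ℕ.suc m ℕ.+ r) (λ t → ext P t * ext x (toℕ i ℕ.+ t))
      ≈⟨ sumℕ-ext P r (λ t → ext x (toℕ i ℕ.+ t)) ⟩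
    dot P (window {m} {k} x i) ∎
    where
    r : ℕ
    r = k ℕ.∸ toℕ i
    length≡ : ℕ.suc (m ℕ.+ k) ≡ toℕ i ℕ.+ (ℕ.suc m ℕ.+ r)
    length≡ = ≡.sym (≡.trans (NP.+-suc (toℕ i) (m ℕ.+ r)) (≡.cong ℕ.suc
      (≡.trans (ℕ-x∙yz≈y∙xz (toℕ i) m r) (≡.cong (m ℕ.+_) (NP.m+[n∸m]≡n (ℕ.s≤s⁻¹ (toℕ<n i)))))))

  dot-mulCoeffs : ∀ m k (P : Vect (ℕ.suc m)) (x : Vect (ℕ.suc (m ℕ.+ k))) (q : Vect (ℕ.suc k)) →
                  dot (mulCoeffs {k} {m} q P) x ≈ sumF (ℕ.suc k) (λ i → q i * dot P (window {m} {k} x i))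
  dot-mulCoeffs m k P x q = begin
    sumF N (λ n → sumF (ℕ.suc k) (λ i → q i * a n i) * x n)
      ≡⟨ sumF≡sum N (λ n → sumF (ℕ.suc k) (λ i → q i * a n i) * x n) ⟩
    sum (λ n → sumF (ℕ.suc k) (λ i → q i * a n i) * x n)
      ≈⟨ sum-cong-≋ (λ n → trans (*-congʳ (reflexive (sumF≡sum (ℕ.suc k) (λ i → q i * a n i))))
                                 (*-distribʳ-sum (x n) (λ i → q i * a n i))) ⟩
    sum (λ n → sum (λ i → q i * a n i * x n))
      ≈⟨ ∑-comm (λ n i → q i * a n i * x n) ⟩
    sum (λ i → sum (λ n → q i * a n i * x n))
      ≈⟨ sum-cong-≋ (λ i → trans (sum-cong-≋ (λ n → *-assoc (q i) (a n i) (x n)))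
                                 (sym (*-distribˡ-sum (q i) (λ n → a n i * x n)))) ⟩
    sum (λ i → q i * sum (λ n → a n i * x n))
      ≈⟨ sum-cong-≋ (λ i → *-congˡ {q i} (dot-shifted≈dot-window m k P x i)) ⟩
    sum (λ i → q i * dot P (window {m} {k} x i))
      ≡⟨ ≡.sym (sumF≡sum (ℕ.suc k) (λ i → q i * dot P (window {m} {k} x i))) ⟩
    sumF (ℕ.suc k) (λ i → q i * dot P (window {m} {k} x i)) ∎
    where
    N : ℕ
    N = ℕ.suc (m ℕ.+ k)
    a : Fin N → Fin (ℕ.suc k) → Carrier
    a n i = shiftedCoeff P (toℕ n) (toℕ i)

lemma4 : ∀ {c ℓ : Level} (𝔽 : Field c ℓ) → Lemma4Statement 𝔽
lemma4 𝔽 m k P x Q _ independent QP⊥x w (a , w≈) = begin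
  dot P w                                   ≈⟨ dot-span P W a w≈ ⟩
  sumF (ℕ.suc k) (λ j → a j * dot P (W j))  ≈⟨ sumF-≈0 (λ j → trans (*-congˡ (P⊥W j)) (zeroʳ (a j))) ⟩
  0#                                        ∎
  where
  open Field 𝔽 hiding (zero)
  open FieldDefs 𝔽
  open LinearAlgebra 𝔽
  open Convolution 𝔽
  open import Relation.Binary.Reasoning.Setoid setoid
  W : Fin (ℕ.suc k) → Vect (ℕ.suc m)
  W = window {m} {k} x
  x∈⟨x⟩ : InSpan (λ (_ : Fin 1) → x) x
  x∈⟨x⟩ = (λ _ → 1#) , λ t → sym (trans (+-identityʳ _) (*-identityˡ _))
  P⊥W : ∀ j → dot P (W j) ≈ 0#
  P⊥W = independent⇒kernel-trivial Q independent (λ j → dot P (W j))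
          (λ l → trans (sym (dot-mulCoeffs m k P x (Q l))) (QP⊥x l x x∈⟨x⟩))
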